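{- Let $p$ be an odd prime, $n\ge1$, $d\in(\mathbb{Z}/p^n\mathbb{Z})^\times$ an element of order $p^{n-1}$, and $r$ an integer with $0\le r<p^{n-1}$. Let the additive group $\mathbb{Z}/p^n\mathbb{Z}$ act on the set $\mathbb{Z}/p^n\mathbb{Z}$ by $i\cdot_r j=jd^{ir}$. For $j\in\mathbb{Z}/p^n\mathbb{Z}$ let $m=\max\{n-1-v_p(j)-v_p(r),0\}$. Then the orbit of $j$ is $\mathcal{O}(j)=\{jd^{ir}:0\le i<p^m\}$ and the stabilizer of $j$ is the subgroup $\langle p^m\rangle$ of $\mathbb{Z}/p^n\mathbb{Z}$.
   Context: $v_p$ denotes the $p$-adic valuation; for $j\in\mathbb{Z}/p^n\mathbb{Z}$ nonzero, $v_p(j)$ is the valuation of any integer representative, and $v_p(0)=\infty$ (so $m=0$ when $j=0$ or $r=0$). -}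

module Defs where

open import Data.Nat using (ℕ; zero; suc; _+_; _*_; _∸_; _^_; _<_; _%_)
open import Data.Nat.Divisibility using (_∣_)
open import Data.Product using (Σ; ∃; _×_; _,_)
open import Data.Sum using (_⊎_)
open import Relation.Nullary using (¬_)
open import Relation.Binary.PropositionalEquality using (_≡_; _≢_)

-- Reduction modulo N (the canonical representative in {0,…,N-1}); N = 0 never occurs below.
mod : ℕ → ℕ → ℕ
mod zero    a = a
mod (suc k) a = a % suc k

-- Elements of ℤ/Nℤ are represented by their canonical representatives a < N.

MultOrder : (N d k : ℕ) → Set
MultOrder N d k = (0 < k) × (mod N (d ^ k) ≡ 1) × (∀ l → 0 < l → l < k → mod N (d ^ l) ≢ 1)

IsValuation : (p a v : ℕ) → Set
IsValuation p a v = (p ^ v ∣ a) × ¬ (p ^ suc v ∣ a)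

-- m = max{n - 1 - v_p(j) - v_p(r), 0}, with v_p(0) = ∞ (so m = 0 if j = 0 or r = 0).
IsM : (p n j r m : ℕ) → Set
IsM p n j r m =
  ((j ≡ 0 ⊎ r ≡ 0) × m ≡ 0)
  ⊎ ((j ≢ 0) × (r ≢ 0) × ∃ λ a → ∃ λ b →
       IsValuation p j a × IsValuation p r b × m ≡ (n ∸ 1) ∸ (a + b))

act : (N d r i j : ℕ) → ℕ
act N d r i j = mod N (j * d ^ (i * r))

InOrbit : (N d r j x : ℕ) → Set
InOrbit N d r j x = ∃ λ i → (i < N) × (x ≡ act N d r i j)

InStabilizer : (N d r j i : ℕ) → Set
InStabilizer N d r j i = (i < N) × (act N d r i j ≡ j)

InCyclicSubgroup : (N g i : ℕ) → Set
InCyclicSubgroup N g i = (i < N) × ∃ λ k → i ≡ mod N (k * g)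

-- Since d^(p^(n-1)) ≡ 1 (mod p^n), Fermat's little theorem gives d ≡ 1 (mod p), and the
-- binomial theorem lifts this to d^(p^c) ≡ 1 (mod p^(c+1)).  Conversely, if d^s ≡ 1 (mod p^(c+1))
-- with c ≤ n-1, then so is d^t for t = s mod p^c; lifting once more gives d^(t p^(n-1-c)) ≡ 1
-- (mod p^n) with t p^(n-1-c) < p^(n-1), so minimality of the order forces t = 0.  Hence
-- d^s ≡ 1 (mod p^(c+1)) iff p^c ∣ s.  Writing j = J p^a and r = R p^b with p ∤ J R, i fixes j
-- iff d^(ir) ≡ 1 (mod p^(n-a)), iff p^(n-1-a) ∣ i r, iff p^m ∣ i.  So the stabilizer is ⟨p^m⟩,
-- i ↦ i ·_r j is p^m-periodic, and the orbit is traced out by 0 ≤ i < p^m.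
{-# OPTIONS --safe #-}
module Submission where

open import Defs
open import Data.Nat using (ℕ; _∸_; _^_; _<_; _≤_)
open import Data.Nat.Primality using (Prime)
open import Data.Nat.Coprimality using (Coprime)
open import Data.Product using (∃; _×_; _,_)
open import Function.Bundles using (_⇔_)
open import Relation.Binary.PropositionalEquality using (_≡_; _≢_)

open import Data.Nat
  using (zero; suc; _+_; _*_; _%_; _/_; z≤n; s≤s; NonZero; ≢-nonZero; >-nonZero⁻¹; nonTrivial⇒n>1; +-*-rawSemiring)
open import Data.Nat.Properties
open import Data.Nat.Divisibility
open import Data.Nat.DivMod
open import Data.Nat.Primality using (euclidsLemma; prime⇒nonZero; prime⇒nonTrivial)
open import Data.Nat.Combinatorics using (_C_; nC1≡n; nCn≡1; nCk+nC[k+1]≡[n+1]C[k+1])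
open import Data.Nat.Tactic.RingSolver using (solve-∀)
open import Data.Fin.Base using (Fin; zero; suc; toℕ; inject₁; fromℕ)
open import Data.Fin.Properties using (toℕ-inject₁; toℕ-fromℕ; toℕ<n)
open import Data.Product using (proj₁; proj₂)
open import Data.Sum using (inj₁; inj₂)
open import Data.Empty using (⊥-elim)
open import Relation.Nullary using (¬_; yes; no)
open import Relation.Binary.PropositionalEquality
  using (refl; sym; trans; cong; cong₂; subst; subst₂; module ≡-Reasoning)
open import Function.Bundles using (mk⇔; Equivalence)
open import Function.Related.Propositional using (module EquationalReasoning)
open import Algebra.Properties.CommutativeSemigroup *-commutativeSemigroup
  using (xy∙z≈xz∙y; x∙yz≈xz∙y; x∙yz≈z∙xy)
open import Algebra.Properties.Monoid.Sum +-0-monoid using (sum; sum-init-last; sum-cong-≗)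
import Algebra.Properties.CommutativeSemiring.Binomial +-*-commutativeSemiring as Binomial
import Algebra.Definitions.RawSemiring +-*-rawSemiring as Raw

mod≡% : ∀ M .{{_ : NonZero M}} x → mod M x ≡ x % M
mod≡% (suc M) x = refl

%-congʳ-+ : ∀ {a b} c {d} .{{_ : NonZero d}} → a % d ≡ b % d → (c + a) % d ≡ (c + b) % d
%-congʳ-+ {a} {b} c {d} eq = begin
  (c + a) % d          ≡⟨ %-distribˡ-+ c a d ⟩
  (c % d + a % d) % d  ≡⟨ cong (λ x → (c % d + x) % d) eq ⟩
  (c % d + b % d) % d  ≡⟨ %-distribˡ-+ c b d ⟨
  (c + b) % d          ∎
  where open ≡-Reasoning

[m%d*n]%d≡[m*n]%d : ∀ m n d .{{_ : NonZero d}} → (m % d * n) % d ≡ (m * n) % d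
[m%d*n]%d≡[m*n]%d m n d = begin
  (m % d * n) % d            ≡⟨ %-distribˡ-* (m % d) n d ⟩
  (m % d % d * (n % d)) % d  ≡⟨ cong (λ x → (x * (n % d)) % d) (m%n%n≡m%n m d) ⟩
  (m % d * (n % d)) % d      ≡⟨ %-distribˡ-* m n d ⟨
  (m * n) % d                ∎
  where open ≡-Reasoning

[m+n]%d≡m⇔d∣n : ∀ {m n d} .{{_ : NonZero d}} → m < d → (m + n) % d ≡ m ⇔ d ∣ n
[m+n]%d≡m⇔d∣n {m} {n} {d} m<d = mk⇔
  (λ eq → divides ((m + n) / d)
            (+-cancelˡ-≡ m n _ (trans (m≡m%n+[m/n]*n (m + n) d) (cong (_+ (m + n) / d * d) eq))))
  (λ d∣n → trans (%-remove-+ʳ m d∣n) (m<n⇒m%n≡m m<d))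

^-monoʳ-∣ : ∀ p {m n} → m ≤ n → p ^ m ∣ p ^ n
^-monoʳ-∣ p {m} {n} m≤n = divides (p ^ (n ∸ m)) (begin
  p ^ n                ≡⟨ cong (p ^_) (m+[n∸m]≡n m≤n) ⟨
  p ^ (m + (n ∸ m))    ≡⟨ ^-distribˡ-+-* p m (n ∸ m) ⟩
  p ^ m * p ^ (n ∸ m)  ≡⟨ *-comm (p ^ m) _ ⟩
  p ^ (n ∸ m) * p ^ m  ∎)
  where open ≡-Reasoning

p^c∣x*p^b⇔p^[c∸b]∣x : ∀ p .{{_ : NonZero p}} c b x → p ^ c ∣ x * p ^ b ⇔ p ^ (c ∸ b) ∣ x
p^c∣x*p^b⇔p^[c∸b]∣x p c b x with c ≤? b
... | yes c≤b = mk⇔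
  (λ _ → subst (λ e → p ^ e ∣ x) (sym (m≤n⇒m∸n≡0 c≤b)) (1∣ x))
  (λ _ → ∣-trans (^-monoʳ-∣ p c≤b) (n∣m*n x))
... | no c≰b = mk⇔
  (λ h → *-cancelʳ-∣ (p ^ b) {{m^n≢0 p b}} (subst (_∣ x * p ^ b) p^c≡ h))
  (λ h → subst (_∣ x * p ^ b) (sym p^c≡) (*-monoˡ-∣ (p ^ b) h))
  where
  p^c≡ : p ^ c ≡ p ^ (c ∸ b) * p ^ b
  p^c≡ = trans (cong (p ^_) (sym (m∸n+n≡m (≰⇒≥ c≰b)))) (^-distribˡ-+-* p (c ∸ b) b)

p^k∣n*o⇔p^k∣o : ∀ {p n o} k → Prime p → ¬ p ∣ n → p ^ k ∣ n * o ⇔ p ^ k ∣ o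
p^k∣n*o⇔p^k∣o {p} {n} k p-prime p∤n = mk⇔ (cancel k) (∣n⇒∣m*n n)
  where
  instance p≢0 = prime⇒nonZero p-prime
  cancel : ∀ {o} k → p ^ k ∣ n * o → p ^ k ∣ o
  cancel {o} zero    _          = 1∣ o
  cancel {o} (suc k) p^[1+k]∣no with euclidsLemma n o p-prime (∣-trans (m∣m*n (p ^ k)) p^[1+k]∣no)
  ... | inj₁ p∣n                = ⊥-elim (p∤n p∣n)
  ... | inj₂ (divides o′ refl)  =
    subst (p ^ suc k ∣_) (*-comm p o′)
      (*-monoʳ-∣ p (cancel k (*-cancelˡ-∣ p (subst (p ^ suc k ∣_) (x∙yz≈z∙xy n o′ p) p^[1+k]∣no))))

p^a∣x<p^n⇒a<n : ∀ {p x a n} .{{_ : NonZero p}} → x ≢ 0 → p ^ a ∣ x → x < p ^ n → a < n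
p^a∣x<p^n⇒a<n {p} {x} {a} {n} x≢0 p^a∣x x<p^n with a <? n
... | yes a<n = a<n
... | no  a≮n = ⊥-elim (<⇒≱ x<p^n (≤-trans (^-monoʳ-≤ p (≮⇒≥ a≮n)) (∣⇒≤ {{≢-nonZero x≢0}} p^a∣x)))

IsValuation⇒x≡X*p^a : ∀ {p x a} → IsValuation p x a → ∃ λ X → x ≡ X * p ^ a × ¬ p ∣ X
IsValuation⇒x≡X*p^a {p} {a = a} (divides X refl , p^[1+a]∤x) =
  X , refl , λ (divides X′ X≡) → p^[1+a]∤x (divides X′ (trans (cong (_* p ^ a) X≡) (*-assoc X′ p (p ^ a))))

-- Fermat's little theorem

[1+k]*[1+n]C[1+k]≡[1+n]*nCk : ∀ n k → suc k * (suc n C suc k) ≡ suc n * (n C k)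
[1+k]*[1+n]C[1+k]≡[1+n]*nCk zero    zero    = refl
[1+k]*[1+n]C[1+k]≡[1+n]*nCk zero    (suc k) = *-zeroʳ (suc (suc k))
[1+k]*[1+n]C[1+k]≡[1+n]*nCk (suc n) zero    =
  trans (*-identityˡ _) (trans (nC1≡n (suc (suc n))) (sym (*-identityʳ _)))
[1+k]*[1+n]C[1+k]≡[1+n]*nCk (suc n) (suc k) = begin
  (2 + k) * ((2 + n) C (2 + k))                      ≡⟨ cong ((2 + k) *_) (nCk+nC[k+1]≡[n+1]C[k+1] (suc n) (suc k)) ⟨
  (2 + k) * (A + B)                                  ≡⟨ *-distribˡ-+ (2 + k) A B ⟩
  A + (1 + k) * A + (2 + k) * B                      ≡⟨ cong₂ (λ x y → A + x + y) ([1+k]*[1+n]C[1+k]≡[1+n]*nCk n k)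
                                                                               ([1+k]*[1+n]C[1+k]≡[1+n]*nCk n (suc k)) ⟩
  A + (1 + n) * (n C k) + (1 + n) * (n C (1 + k))    ≡⟨ +-assoc A _ _ ⟩
  A + ((1 + n) * (n C k) + (1 + n) * (n C (1 + k)))  ≡⟨ cong (A +_) (*-distribˡ-+ (1 + n) (n C k) _) ⟨
  A + (1 + n) * (n C k + n C (1 + k))                ≡⟨ cong (λ x → A + (1 + n) * x) (nCk+nC[k+1]≡[n+1]C[k+1] n k) ⟩
  (2 + n) * A                                        ∎
  where
  open ≡-Reasoning
  A = (1 + n) C (1 + k)
  B = (1 + n) C (2 + k)

p∣pCk : ∀ {p k} → Prime p → 0 < k → k < p → p ∣ p C k
p∣pCk {suc p′} {suc k′} p-prime _ k<p
  with euclidsLemma (suc k′) (suc p′ C suc k′) p-prime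
         (divides (p′ C k′) (trans ([1+k]*[1+n]C[1+k]≡[1+n]*nCk p′ k′) (*-comm (suc p′) _)))
... | inj₁ p∣k = ⊥-elim (<⇒≱ k<p (∣⇒≤ p∣k))
... | inj₂ p∣C = p∣C

∣-sum : ∀ {d n} (f : Fin n → ℕ) → (∀ i → d ∣ f i) → d ∣ sum f
∣-sum {d} {zero}  f _ = d ∣0
∣-sum {n = suc n} f h = ∣m∣n⇒∣m+n (h zero) (∣-sum (λ i → f (suc i)) (λ i → h (suc i)))

binomial-theorem : ∀ n x y → (x + y) ^ n ≡ sum (λ (k : Fin (suc n)) → (n C toℕ k) * (x ^ toℕ k * y ^ (n ∸ toℕ k)))
binomial-theorem n x y = begin
  (x + y) ^ n                       ≡⟨ ^ᴿ≡^ (x + y) n ⟨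
  (x + y) Raw.^ n                   ≡⟨ Binomial.theorem n x y ⟩
  Binomial.binomialExpansion x y n  ≡⟨ sum-cong-≗ term≡ ⟩
  sum (λ (k : Fin (suc n)) → (n C toℕ k) * (x ^ toℕ k * y ^ (n ∸ toℕ k))) ∎
  where
  open ≡-Reasoning
  ×≡* : ∀ m z → m Raw.× z ≡ m * z
  ×≡* zero    z = refl
  ×≡* (suc m) z = cong (z +_) (×≡* m z)
  ^ᴿ≡^ : ∀ z m → z Raw.^ m ≡ z ^ m
  ^ᴿ≡^ z zero    = refl
  ^ᴿ≡^ z (suc m) = cong (z *_) (^ᴿ≡^ z m)
  term≡ : ∀ k → Binomial.binomialTerm x y n k ≡ (n C toℕ k) * (x ^ toℕ k * y ^ (n ∸ toℕ k))
  term≡ k = trans (×≡* (n C toℕ k) _) (cong ((n C toℕ k) *_) (cong₂ _*_ (^ᴿ≡^ x (toℕ k)) (^ᴿ≡^ y (n ∸ toℕ k))))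

[x+1]^p%p≡[1+x^p]%p : ∀ {p} .{{_ : NonZero p}} → Prime p → ∀ x → (x + 1) ^ p % p ≡ (1 + x ^ p) % p
[x+1]^p%p≡[1+x^p]%p {p@(suc p′)} p-prime x = begin
  (x + 1) ^ p % p                                      ≡⟨ %-congˡ (binomial-theorem p x 1) ⟩
  (T zero + sum (λ i → T (suc i))) % p                 ≡⟨ %-congˡ (cong (T zero +_) (sum-init-last (λ i → T (suc i)))) ⟩
  (T zero + (sum middle + T (suc (fromℕ p′)))) % p     ≡⟨ %-congˡ (cong₂ (λ x y → x + (sum middle + y)) first last) ⟩
  (1 + (sum middle + x ^ p)) % p                       ≡⟨ %-congʳ-+ 1 {p} (%-remove-+ˡ (x ^ p) (∣-sum middle p∣middle)) ⟩
  (1 + x ^ p) % p                                      ∎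
  where
  open ≡-Reasoning
  T : Fin (suc p) → ℕ
  T k = (p C toℕ k) * (x ^ toℕ k * 1 ^ (p ∸ toℕ k))
  middle : Fin p′ → ℕ
  middle i = T (suc (inject₁ i))
  first : T zero ≡ 1
  first = trans (*-identityˡ (1 * 1 ^ p)) (trans (*-identityˡ (1 ^ p)) (^-zeroˡ p))
  last : T (suc (fromℕ p′)) ≡ x ^ p
  last rewrite toℕ-fromℕ p′ | nCn≡1 p | n∸n≡0 p′ = trans (+-identityʳ _) (*-identityʳ _)
  p∣middle : ∀ i → p ∣ middle i
  p∣middle i = ∣m⇒∣m*n _ (p∣pCk p-prime (s≤s z≤n) (s≤s (subst (_< p′) (sym (toℕ-inject₁ i)) (toℕ<n i))))

fermatsLittleTheorem : ∀ {p} .{{_ : NonZero p}} → Prime p → ∀ x → x ^ p % p ≡ x % p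
fermatsLittleTheorem {suc p′} _ zero = refl
fermatsLittleTheorem {p} p-prime (suc x) = begin
  (1 + x) ^ p % p  ≡⟨ %-congˡ (cong (_^ p) (+-comm 1 x)) ⟩
  (x + 1) ^ p % p  ≡⟨ [x+1]^p%p≡[1+x^p]%p p-prime x ⟩
  (1 + x ^ p) % p  ≡⟨ %-congʳ-+ 1 {p} (fermatsLittleTheorem p-prime x) ⟩
  (1 + x) % p      ∎
  where open ≡-Reasoning

x^p^e%p≡x%p : ∀ {p} .{{_ : NonZero p}} → Prime p → ∀ x e → x ^ (p ^ e) % p ≡ x % p
x^p^e%p≡x%p p-prime x zero = %-congˡ (*-identityʳ x)
x^p^e%p≡x%p {p} p-prime x (suc e) = begin
  x ^ (p * p ^ e) % p    ≡⟨ %-congˡ (trans (^-*-assoc x (p ^ e) p) (cong (x ^_) (*-comm (p ^ e) p))) ⟨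
  (x ^ (p ^ e)) ^ p % p  ≡⟨ fermatsLittleTheorem p-prime (x ^ (p ^ e)) ⟩
  x ^ (p ^ e) % p        ≡⟨ x^p^e%p≡x%p p-prime x e ⟩
  x % p                  ∎
  where open ≡-Reasoning

-- Congruence to 1 and its lifting to higher prime powers

infix 4 _≡1mod_

_≡1mod_ : ℕ → ℕ → Set
x ≡1mod M = ∃ λ u → x ≡ 1 + u * M

≡1mod-* : ∀ {M x y} → x ≡1mod M → y ≡1mod M → x * y ≡1mod M
≡1mod-* {M} (u , refl) (v , refl) = u + v + u * v * M , lemma u v M
  where
  lemma : ∀ u v M → (1 + u * M) * (1 + v * M) ≡ 1 + (u + v + u * v * M) * M
  lemma = solve-∀

≡1mod-^ : ∀ {M x} → x ≡1mod M → ∀ k → x ^ k ≡1mod M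
≡1mod-^ _  zero    = 0 , refl
≡1mod-^ x≡ (suc k) = ≡1mod-* x≡ (≡1mod-^ x≡ k)

≡1mod-∣ : ∀ {M M′ x} → M ∣ M′ → x ≡1mod M′ → x ≡1mod M
≡1mod-∣ {M} (divides q refl) (u , refl) = u * q , cong suc (sym (*-assoc u q M))

M∣n⇔1+n≡1mod : ∀ {M n} → M ∣ n ⇔ 1 + n ≡1mod M
M∣n⇔1+n≡1mod = mk⇔ (λ (divides u eq) → u , cong suc eq) (λ (u , eq) → divides u (suc-injective eq))

≡1mod⇔%≡1 : ∀ {M x} .{{_ : NonZero M}} → 1 < M → x ≡1mod M ⇔ x % M ≡ 1
≡1mod⇔%≡1 {M} {x} 1<M = mk⇔
  (λ (u , eq) → trans (%-congˡ eq) (trans ([m+kn]%n≡m%n 1 u M) (m<n⇒m%n≡m 1<M)))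
  (λ eq → x / M , trans (m≡m%n+[m/n]*n x M) (cong (_+ (x / M) * M) eq))

≡1mod-cancelʳ : ∀ {M x y} .{{_ : NonZero M}} → 1 < M → y ≡1mod M → x * y ≡1mod M → x ≡1mod M
≡1mod-cancelʳ {M} {x} 1<M (v , refl) xy≡1 = Equivalence.from (≡1mod⇔%≡1 1<M) (begin
  x % M                  ≡⟨ [m+kn]%n≡m%n x (x * v) M ⟨
  (x + x * v * M) % M    ≡⟨ %-congˡ (lemma x v M) ⟩
  (x * (1 + v * M)) % M  ≡⟨ Equivalence.to (≡1mod⇔%≡1 1<M) xy≡1 ⟩
  1                      ∎)
  where
  open ≡-Reasoning
  lemma : ∀ x v M → x + x * v * M ≡ x * (1 + v * M)
  lemma = solve-∀

[1+a]^n≡1+n*a+b*a² : ∀ a n → ∃ λ b → (1 + a) ^ n ≡ 1 + n * a + b * (a * a)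
[1+a]^n≡1+n*a+b*a² a zero    = 0 , refl
[1+a]^n≡1+n*a+b*a² a (suc n) with [1+a]^n≡1+n*a+b*a² a n
... | b , eq = b + n + b * a , trans (cong ((1 + a) *_) eq) (lemma a n b)
  where
  lemma : ∀ a n b → (1 + a) * (1 + n * a + b * (a * a)) ≡ 1 + (1 + n) * a + (b + n + b * a) * (a * a)
  lemma = solve-∀

≡1mod-lift : ∀ p Q {x} → x ≡1mod p * Q → x ^ p ≡1mod p * (p * Q)
≡1mod-lift p Q (u , refl) with [1+a]^n≡1+n*a+b*a² (u * (p * Q)) p
... | b , eq = u + b * u * u * Q , trans eq (lemma p Q u b)
  where
  lemma : ∀ p Q u b → 1 + p * (u * (p * Q)) + b * (u * (p * Q) * (u * (p * Q)))
                    ≡ 1 + (u + b * u * u * Q) * (p * (p * Q))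
  lemma = solve-∀

≡1mod-lift-^ : ∀ p k {x} → x ≡1mod p ^ suc k → ∀ e → x ^ (p ^ e) ≡1mod p ^ (suc k + e)
≡1mod-lift-^ p k {x} x≡1 zero =
  subst₂ _≡1mod_ (sym (*-identityʳ x)) (cong (p ^_) (sym (+-identityʳ (suc k)))) x≡1
≡1mod-lift-^ p k {x} x≡1 (suc e) =
  subst₂ _≡1mod_ (trans (^-*-assoc x (p ^ e) p) (cong (x ^_) (*-comm (p ^ e) p))) (cong (p ^_) (sym (+-suc (suc k) e)))
    (≡1mod-lift p (p ^ (k + e)) (≡1mod-lift-^ p k x≡1 e))

-- Orbits and stabilizers of a periodic action

act-fixes-zero : ∀ N .{{_ : NonZero N}} d r i → act N d r i 0 ≡ 0
act-fixes-zero N d r i = trans (mod≡% N 0) (m<n⇒m%n≡m (>-nonZero⁻¹ N))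

act-fixes-when-r≡0 : ∀ {N j} .{{_ : NonZero N}} d i → j < N → act N d 0 i j ≡ j
act-fixes-when-r≡0 {N} {j} d i j<N = begin
  mod N (j * d ^ (i * 0))  ≡⟨ mod≡% N _ ⟩
  (j * d ^ (i * 0)) % N    ≡⟨ %-congˡ (trans (cong (λ k → j * d ^ k) (*-zeroʳ i)) (*-identityʳ j)) ⟩
  j % N                    ≡⟨ m<n⇒m%n≡m j<N ⟩
  j                        ∎
  where open ≡-Reasoning

module _ {N} .{{_ : NonZero N}} (d r j : ℕ) {g} .{{_ : NonZero g}} (g∣N : g ∣ N)
         (act-fixes⇔g∣ : ∀ i → act N d r i j ≡ j ⇔ g ∣ i) where

  act-periodic : ∀ i k → act N d r (i + k * g) j ≡ act N d r i j
  act-periodic i k = begin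
    mod N (j * d ^ ((i + k * g) * r))              ≡⟨ mod≡% N _ ⟩
    (j * d ^ ((i + k * g) * r)) % N                ≡⟨ %-congˡ (cong (j *_) d^[[i+kg]r]≡) ⟩
    (j * (d ^ (i * r) * d ^ (k * g * r))) % N      ≡⟨ %-congˡ (x∙yz≈xz∙y j (d ^ (i * r)) _) ⟩
    (j * d ^ (k * g * r) * d ^ (i * r)) % N        ≡⟨ [m%d*n]%d≡[m*n]%d _ (d ^ (i * r)) N ⟨
    ((j * d ^ (k * g * r)) % N * d ^ (i * r)) % N  ≡⟨ cong (λ x → (x * d ^ (i * r)) % N) kg-fixes ⟩
    (j * d ^ (i * r)) % N                          ≡⟨ mod≡% N _ ⟨
    mod N (j * d ^ (i * r))                        ∎
    where
    open ≡-Reasoning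
    d^[[i+kg]r]≡ : d ^ ((i + k * g) * r) ≡ d ^ (i * r) * d ^ (k * g * r)
    d^[[i+kg]r]≡ = trans (cong (d ^_) (*-distribʳ-+ r i (k * g))) (^-distribˡ-+-* d (i * r) (k * g * r))
    kg-fixes : (j * d ^ (k * g * r)) % N ≡ j
    kg-fixes = trans (sym (mod≡% N _)) (Equivalence.from (act-fixes⇔g∣ (k * g)) (n∣m*n k))

  orbit⇔ : ∀ x → InOrbit N d r j x ⇔ (∃ λ i → (i < g) × (x ≡ act N d r i j))
  orbit⇔ x = mk⇔
    (λ (i , _ , x≡) → i % g , m%n<n i g ,
       trans x≡ (trans (cong (λ i → act N d r i j) (m≡m%n+[m/n]*n i g)) (act-periodic (i % g) (i / g))))
    (λ (i , i<g , x≡) → i , <-≤-trans i<g (∣⇒≤ g∣N) , x≡)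

  stabilizer⇔ : ∀ i → InStabilizer N d r j i ⇔ InCyclicSubgroup N g i
  stabilizer⇔ i = mk⇔
    (λ (i<N , fixed) → let divides k i≡k*g = Equivalence.to (act-fixes⇔g∣ i) fixed in
       i<N , k , trans (sym (m<n⇒m%n≡m i<N)) (trans (%-congˡ i≡k*g) (sym (mod≡% N _))))
    (λ (i<N , k , i≡) → i<N ,
       Equivalence.from (act-fixes⇔g∣ i) (subst (g ∣_) (sym (trans i≡ (mod≡% N _))) (%-presˡ-∣ (n∣m*n k) g∣N)))

-- Powers of an element of order p^(n-1) modulo p^n

order-minimal : ∀ {M d k l} → MultOrder M d k → l < k → mod M (d ^ l) ≡ 1 → l ≡ 0
order-minimal {l = zero}  _                 _   _  = refl
order-minimal {l = suc l} (_ , _ , minimal) l<k eq = ⊥-elim (minimal (suc l) (s≤s z≤n) l<k eq)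

module _ {p} (p-prime : Prime p) (n₁ d : ℕ) (order : MultOrder (p ^ suc n₁) d (p ^ n₁)) where

  private
    instance
      p≢0 : NonZero p
      p≢0 = prime⇒nonZero p-prime
      N≢0 : NonZero (p ^ suc n₁)
      N≢0 = m^n≢0 p (suc n₁)

    1<p^[1+k] : ∀ k → 1 < p ^ suc k
    1<p^[1+k] k = <-≤-trans (nonTrivial⇒n>1 p {{prime⇒nonTrivial p-prime}}) (m≤m*n p (p ^ k) {{m^n≢0 p k}})

  d≡1mod[p] : d ≡1mod p
  d≡1mod[p] = Equivalence.from (≡1mod⇔%≡1 1<p) (begin
    d % p             ≡⟨ x^p^e%p≡x%p p-prime d n₁ ⟨
    d ^ (p ^ n₁) % p  ≡⟨ Equivalence.to (≡1mod⇔%≡1 1<p) d^p^n₁≡1mod[p] ⟩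
    1                 ∎)
    where
    open ≡-Reasoning
    1<p : 1 < p
    1<p = nonTrivial⇒n>1 p {{prime⇒nonTrivial p-prime}}
    d^p^n₁≡1mod[p] : d ^ (p ^ n₁) ≡1mod p
    d^p^n₁≡1mod[p] = ≡1mod-∣ (m∣m*n (p ^ n₁))
      (Equivalence.from (≡1mod⇔%≡1 (1<p^[1+k] n₁)) (trans (sym (mod≡% (p ^ suc n₁) _)) (proj₁ (proj₂ order))))

  d^p^c≡1mod[p^[1+c]] : ∀ c → d ^ (p ^ c) ≡1mod p ^ suc c
  d^p^c≡1mod[p^[1+c]] = ≡1mod-lift-^ p 0 (subst (d ≡1mod_) (sym (*-identityʳ p)) d≡1mod[p])

  d^t≡1mod⇒t≡0 : ∀ {c t} → c ≤ n₁ → t < p ^ c → d ^ t ≡1mod p ^ suc c → t ≡ 0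
  d^t≡1mod⇒t≡0 {c} {t} c≤n₁ t<p^c d^t≡1 =
    m*n≡0⇒m≡0 t (p ^ e) {{m^n≢0 p e}} (order-minimal {p ^ suc n₁} {d} order t*p^e<p^n₁ d^[t*p^e]≡1)
    where
    e = n₁ ∸ c
    c+e≡n₁ : c + e ≡ n₁
    c+e≡n₁ = m+[n∸m]≡n c≤n₁
    t*p^e<p^n₁ : t * p ^ e < p ^ n₁
    t*p^e<p^n₁ = subst (t * p ^ e <_) (trans (sym (^-distribˡ-+-* p c e)) (cong (p ^_) c+e≡n₁))
                   (*-monoˡ-< (p ^ e) {{m^n≢0 p e}} t<p^c)
    d^[t*p^e]≡1 : mod (p ^ suc n₁) (d ^ (t * p ^ e)) ≡ 1
    d^[t*p^e]≡1 = trans (mod≡% (p ^ suc n₁) _) (Equivalence.to (≡1mod⇔%≡1 (1<p^[1+k] n₁))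
      (subst₂ _≡1mod_ (^-*-assoc d t (p ^ e)) (cong (λ k → p ^ suc k) c+e≡n₁) (≡1mod-lift-^ p c d^t≡1 e)))

  d^s≡1mod⇔p^c∣s : ∀ {c s} → c ≤ n₁ → d ^ s ≡1mod p ^ suc c ⇔ p ^ c ∣ s
  d^s≡1mod⇔p^c∣s {c} {s} c≤n₁ = mk⇔ to from
    where
    instance p^c≢0 = m^n≢0 p c
    to : d ^ s ≡1mod p ^ suc c → p ^ c ∣ s
    to d^s≡1 = m%n≡0⇒n∣m s (p ^ c) (d^t≡1mod⇒t≡0 c≤n₁ (m%n<n s (p ^ c)) d^t≡1)
      where
      t = s % p ^ c
      q = s / p ^ c
      d^s≡d^t*[d^p^c]^q : d ^ s ≡ d ^ t * (d ^ (p ^ c)) ^ q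
      d^s≡d^t*[d^p^c]^q = begin
        d ^ s                      ≡⟨ cong (d ^_) (m≡m%n+[m/n]*n s (p ^ c)) ⟩
        d ^ (t + q * p ^ c)        ≡⟨ ^-distribˡ-+-* d t (q * p ^ c) ⟩
        d ^ t * d ^ (q * p ^ c)    ≡⟨ cong (λ k → d ^ t * d ^ k) (*-comm q (p ^ c)) ⟩
        d ^ t * d ^ (p ^ c * q)    ≡⟨ cong (d ^ t *_) (^-*-assoc d (p ^ c) q) ⟨
        d ^ t * (d ^ (p ^ c)) ^ q  ∎
        where open ≡-Reasoning
      d^t≡1 : d ^ t ≡1mod p ^ suc c
      d^t≡1 = ≡1mod-cancelʳ {{m^n≢0 p (suc c)}} (1<p^[1+k] c) (≡1mod-^ (d^p^c≡1mod[p^[1+c]] c) q)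
                (subst (_≡1mod p ^ suc c) d^s≡d^t*[d^p^c]^q d^s≡1)
    from : p ^ c ∣ s → d ^ s ≡1mod p ^ suc c
    from (divides q refl) = subst (_≡1mod p ^ suc c) (trans (^-*-assoc d (p ^ c) q) (cong (d ^_) (*-comm (p ^ c) q)))
      (≡1mod-^ (d^p^c≡1mod[p^[1+c]] c) q)

  act-fixes⇔ : ∀ {J R a b} → ¬ p ∣ J → ¬ p ∣ R → J * p ^ a < p ^ suc n₁ →
               ∀ i → act (p ^ suc n₁) d (R * p ^ b) i (J * p ^ a) ≡ J * p ^ a ⇔ p ^ (n₁ ∸ (a + b)) ∣ i
  act-fixes⇔ {J} {R} {a} {b} p∤J p∤R j<N i = begin
    act N d r i j ≡ j                ≡⟨ cong (_≡ j) (trans (mod≡% N _) (%-congˡ j*d^[i*r]≡j+j*e)) ⟩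
    (j + j * e) % N ≡ j              ∼⟨ [m+n]%d≡m⇔d∣n j<N ⟩
    N ∣ j * e                        ≡⟨ cong₂ _∣_ N≡p^[a+1+c] (xy∙z≈xz∙y J (p ^ a) e) ⟩
    p ^ (a + suc c) ∣ J * e * p ^ a  ∼⟨ p^c∣x*p^b⇔p^[c∸b]∣x p (a + suc c) a (J * e) ⟩
    p ^ (a + suc c ∸ a) ∣ J * e      ≡⟨ cong (λ k → p ^ k ∣ J * e) (m+n∸m≡n a (suc c)) ⟩
    p ^ suc c ∣ J * e                ∼⟨ p^k∣n*o⇔p^k∣o (suc c) p-prime p∤J ⟩
    p ^ suc c ∣ e                    ∼⟨ M∣n⇔1+n≡1mod ⟩
    1 + e ≡1mod p ^ suc c            ≡⟨ cong (_≡1mod p ^ suc c) (sym d^[i*r]≡1+e) ⟩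
    d ^ (i * r) ≡1mod p ^ suc c      ∼⟨ d^s≡1mod⇔p^c∣s (m∸n≤m n₁ a) ⟩
    p ^ c ∣ i * r                    ≡⟨ cong (p ^ c ∣_) (sym (*-assoc i R (p ^ b))) ⟩
    p ^ c ∣ i * R * p ^ b            ∼⟨ p^c∣x*p^b⇔p^[c∸b]∣x p c b (i * R) ⟩
    p ^ (c ∸ b) ∣ i * R              ≡⟨ cong₂ (λ k x → p ^ k ∣ x) (∸-+-assoc n₁ a b) (*-comm i R) ⟩
    p ^ (n₁ ∸ (a + b)) ∣ R * i       ∼⟨ p^k∣n*o⇔p^k∣o (n₁ ∸ (a + b)) p-prime p∤R ⟩
    p ^ (n₁ ∸ (a + b)) ∣ i           ∎
    where
    open EquationalReasoning
    N = p ^ suc n₁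
    j = J * p ^ a
    r = R * p ^ b
    c = n₁ ∸ a
    -- d ≡ 1 (mod p) writes d^(ir) as 1 + e, so that i fixing j becomes N ∣ j e without subtraction.
    e = proj₁ (≡1mod-^ d≡1mod[p] (i * r)) * p
    d^[i*r]≡1+e : d ^ (i * r) ≡ 1 + e
    d^[i*r]≡1+e = proj₂ (≡1mod-^ d≡1mod[p] (i * r))
    j*d^[i*r]≡j+j*e : j * d ^ (i * r) ≡ j + j * e
    j*d^[i*r]≡j+j*e = trans (cong (j *_) d^[i*r]≡1+e) (trans (*-distribˡ-+ j 1 e) (cong (_+ j * e) (*-identityʳ j)))
    j≢0 : j ≢ 0
    j≢0 j≡0 = p∤J (subst (p ∣_) (sym (m*n≡0⇒m≡0 J (p ^ a) {{m^n≢0 p a}} j≡0)) (p ∣0))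
    a≤n₁ : a ≤ n₁
    a≤n₁ = ≤-pred (p^a∣x<p^n⇒a<n j≢0 (n∣m*n J) j<N)
    N≡p^[a+1+c] : N ≡ p ^ (a + suc c)
    N≡p^[a+1+c] = cong (p ^_) (trans (cong suc (sym (m+[n∸m]≡n a≤n₁))) (sym (+-suc a c)))

  act-fixes⇔p^m∣ : ∀ {j r m} → IsM p (suc n₁) j r m → j < p ^ suc n₁ →
                   ∀ i → act (p ^ suc n₁) d r i j ≡ j ⇔ p ^ m ∣ i
  act-fixes⇔p^m∣ {r = r} (inj₁ (inj₁ refl , refl)) _ i =
    mk⇔ (λ _ → 1∣ i) (λ _ → act-fixes-zero (p ^ suc n₁) d r i)
  act-fixes⇔p^m∣ (inj₁ (inj₂ refl , refl)) j<N i =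
    mk⇔ (λ _ → 1∣ i) (λ _ → act-fixes-when-r≡0 d i j<N)
  act-fixes⇔p^m∣ (inj₂ (_ , _ , a , b , vj , vr , refl)) j<N
    with IsValuation⇒x≡X*p^a {p} {a = a} vj | IsValuation⇒x≡X*p^a {p} {a = b} vr
  ... | _ , refl , p∤J | _ , refl , p∤R = act-fixes⇔ {a = a} {b} p∤J p∤R j<N

IsM⇒m≤n∸1 : ∀ {p n j r m} → IsM p n j r m → m ≤ n ∸ 1
IsM⇒m≤n∸1         (inj₁ (_ , refl))                      = z≤n
IsM⇒m≤n∸1 {n = n} (inj₂ (_ , _ , a , b , _ , _ , refl)) = m∸n≤m (n ∸ 1) (a + b)

lemma4p7 : (p n d r j m : ℕ) → Prime p → p ≢ 2 → 1 ≤ n →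
           d < p ^ n → Coprime d (p ^ n) → MultOrder (p ^ n) d (p ^ (n ∸ 1)) →
           r < p ^ (n ∸ 1) → j < p ^ n → IsM p n j r m →
           (∀ x → InOrbit (p ^ n) d r j x ⇔ (∃ λ i → (i < p ^ m) × (x ≡ act (p ^ n) d r i j)))
           × (∀ i → InStabilizer (p ^ n) d r j i ⇔ InCyclicSubgroup (p ^ n) (p ^ m) i)
lemma4p7 p (suc n₁) d r j m p-prime _ _ _ _ order _ j<N isM =
  orbit⇔ d r j p^m∣N fixes⇔ , stabilizer⇔ d r j p^m∣N fixes⇔
  where
  instance
    p≢0 = prime⇒nonZero p-prime
    N≢0 = m^n≢0 p (suc n₁)
    p^m≢0 = m^n≢0 p m
  p^m∣N : p ^ m ∣ p ^ suc n₁
  p^m∣N = ^-monoʳ-∣ p (m≤n⇒m≤1+n (IsM⇒m≤n∸1 {n = suc n₁} isM))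
  fixes⇔ : ∀ i → act (p ^ suc n₁) d r i j ≡ j ⇔ p ^ m ∣ i
  fixes⇔ = act-fixes⇔p^m∣ p-prime n₁ d order isM j<N
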